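{- Let $l$ and $k$ be positive integers with $\gcd(k,l)=1$ and $k$ odd. Put $d=2l^2+k^2$. (i) If $k\not\equiv l \pmod 3$, then $a=|2l^2+2kl-k^2|$, $c=|k^2+4kl-2l^2|$, together with $d$, form a positive primitive solution of $2a^2+c^2=3d^2$. (ii) If $k\not\equiv -l \pmod 3$, then $a=|2l^2-2kl-k^2|$, $c=|k^2-4kl-2l^2|$, together with $d$, form a positive primitive solution of $2a^2+c^2=3d^2$. Conversely, every positive primitive solution $(a,c,d)$ of $2a^2+c^2=3d^2$ other than the trivial solution $a=c=d=1$ arises in this way: there exist positive integers $l,k$ with $\gcd(k,l)=1$ and $k$ odd such that $d=2l^2+k^2$ and $(a,c)$ is given by the formula in (i) with $k\not\equiv l \pmod 3$, or by the formula in (ii) with $k\not\equiv -l\pmod 3$.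
   Context: A positive primitive solution of $2a^2+c^2=3d^2$ is a triple of positive integers $(a,c,d)$ satisfying the equation with $\gcd(a,c,d)=1$. -}

module Defs where

open import Data.Nat as ℕ using (ℕ; _>_)
open import Data.Nat.GCD using (gcd)
open import Data.Product using (_×_)
open import Data.Integer as ℤ using (ℤ; +_; ∣_∣)
open import Relation.Binary.PropositionalEquality using (_≡_)

PosPrimSol : ℕ → ℕ → ℕ → Set
PosPrimSol a c d =
  a > 0 × c > 0 × d > 0 ×
  (2 ℕ.* (a ℕ.* a) ℕ.+ c ℕ.* c ≡ 3 ℕ.* (d ℕ.* d)) ×
  gcd (gcd a c) d ≡ 1

dOf : ℕ → ℕ → ℕ
dOf l k = 2 ℕ.* (l ℕ.* l) ℕ.+ k ℕ.* k

aI : ℕ → ℕ → ℕ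
aI l k = ∣ + 2 ℤ.* (+ l ℤ.* + l) ℤ.+ + 2 ℤ.* (+ k ℤ.* + l) ℤ.- + k ℤ.* + k ∣

cI : ℕ → ℕ → ℕ
cI l k = ∣ + k ℤ.* + k ℤ.+ + 4 ℤ.* (+ k ℤ.* + l) ℤ.- + 2 ℤ.* (+ l ℤ.* + l) ∣

aII : ℕ → ℕ → ℕ
aII l k = ∣ + 2 ℤ.* (+ l ℤ.* + l) ℤ.- + 2 ℤ.* (+ k ℤ.* + l) ℤ.- + k ℤ.* + k ∣

cII : ℕ → ℕ → ℕ
cII l k = ∣ + k ℤ.* + k ℤ.- + 4 ℤ.* (+ k ℤ.* + l) ℤ.- + 2 ℤ.* (+ l ℤ.* + l) ∣

{-# OPTIONS --safe #-}
-- Write x = 2p − q + 2r, y = q − 2p + 4r, z = 2p + q; then 2x² + y² − 3z² = 24(r² − pq).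
-- The forms a, c, d are these coordinates at (p, q, r) = (l², κ², κl), so they solve the
-- equation; family (i) is κ = k and family (ii) is κ = −k. A common divisor of the forms
-- divides 12l² = 2a − c + 3d and is prime to l, so under gcd(κ, l) = 1, κ odd and
-- κ ≢ l (mod 3) it divides 12 but neither 2 nor 3. Conversely, for a primitive solution a
-- residue computation mod 12 chooses signs x = ±a, y = ±c making p = (2x − y + 3z)/12 and
-- r = (x + y)/6 integers; then pq = r² with gcd(p, q, r) = 1 forces p = l², q = κ², r = κl
-- for l = gcd(p, r), and primitivity of the forms at (l, κ) gives back the three conditions.
module Submission where

open import Defs
open import Data.Nat using (ℕ; _>_; _%_)
open import Data.Nat.GCD using (gcd)
open import Data.Integer using (+_; _-_; _+_)
open import Data.Integer.Divisibility using (_∣_)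
open import Data.Product using (_×_; ∃-syntax)
open import Data.Sum using (_⊎_)
open import Relation.Nullary using (¬_)
open import Relation.Binary.PropositionalEquality using (_≡_)

import Data.Nat as ℕ
open import Data.Nat using (suc; zero; z≤n; s≤s; _<_; _/_)
open import Data.Nat.Properties using (n≢0⇒n>0; allUpTo?; *-cancelˡ-≡; *-comm; *-identityʳ)
open import Data.Nat.Divisibility as ℕᵈ using (divides; ∣-trans; ∣1⇒≡1; _∣?_; ∣n∣m%n⇒∣m) renaming (_∣_ to _∣ₙ_)
open import Data.Nat.DivMod using (m%n<n; m≡m%n+[m/n]*n; %-distribˡ-+; %-distribˡ-*)
open import Data.Nat.GCD using (gcd[m,n]∣m; gcd[m,n]∣n; gcd-greatest; c*gcd[m,n]≡gcd[cm,cn]; gcd[m,n]≡0⇒m≡0; gcd[m,n]≡0⇒n≡0)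
open import Data.Nat.Coprimality using (Coprime; coprime-divisor; gcd≡1⇒coprime; coprime⇒gcd≡1)
import Data.Nat.Coprimality as Coprime
open import Data.Nat.Primality using (Prime; prime?; prime[2]; euclidsLemma)
open import Data.Nat.Tactic.RingSolver using () renaming (solve-∀ to ℕ-solve-∀)
open import Data.Integer using (ℤ; _*_; -_; -[1+_]; ∣_∣; _◃_)
import Data.Integer.Properties as ℤ
open import Data.Integer.Divisibility.Signed as ℤᵈ using (∣ᵤ⇒∣; ∣⇒∣ᵤ) renaming (_∣_ to _∣ₛ_)
open import Data.Integer.Tactic.RingSolver using (solve-∀; solve)
open import Data.Sign as Sign using (Sign)
import Data.Sign.Properties as Signᴾ
open import Data.List using (_∷_; [])
open import Data.Product using (_,_; ∃)
open import Data.Sum using (inj₁; inj₂; [_,_]′)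
open import Data.Empty using (⊥-elim)
open import Function using (_∘_; _⇔_; mk⇔; Equivalence)
open import Relation.Nullary using (Dec; contradiction)
open import Relation.Nullary.Decidable using (from-yes; map′; ¬?; _×-dec_; _⊎-dec_; _→-dec_)
open import Relation.Binary.PropositionalEquality using (refl; sym; trans; cong; cong₂; subst; subst₂; module ≡-Reasoning)

∣ₙ⇒∣ₛ : ∀ {g i} → g ∣ₙ ∣ i ∣ → + g ∣ₛ i
∣ₙ⇒∣ₛ = ∣ᵤ⇒∣

∣ₛ⇒∣ₙ : ∀ {g i} → + g ∣ₛ i → g ∣ₙ ∣ i ∣
∣ₛ⇒∣ₙ = ∣⇒∣ᵤ

∣-neg : ∀ {g i} → + g ∣ₛ - i → + g ∣ₛ i
∣-neg {g} {i} = ∣ₙ⇒∣ₛ ∘ subst (g ∣ₙ_) (ℤ.∣-i∣≡∣i∣ i) ∘ ∣ₛ⇒∣ₙ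

+[∣i∣*∣i∣]≡i*i : ∀ i → + (∣ i ∣ ℕ.* ∣ i ∣) ≡ i * i
+[∣i∣*∣i∣]≡i*i (+ n)    = ℤ.pos-* n n
+[∣i∣*∣i∣]≡i*i -[1+ n ] = refl

prime[3] : Prime 3
prime[3] = from-yes (prime? 3)

prime∣n*n⇒∣n : ∀ {p n} → Prime p → p ∣ₙ n ℕ.* n → p ∣ₙ n
prime∣n*n⇒∣n {n = n} p-prime p∣n*n with euclidsLemma n n p-prime p∣n*n
... | inj₁ p∣n = p∣n
... | inj₂ p∣n = p∣n

prime∣i*i⇒∣i : ∀ {p i} → Prime p → + p ∣ₛ i * i → + p ∣ₛ i
prime∣i*i⇒∣i {i = i} p-prime p∣i*i =
  ∣ₙ⇒∣ₛ (prime∣n*n⇒∣n p-prime (subst (_ ∣ₙ_) (ℤ.abs-* i i) (∣ₛ⇒∣ₙ p∣i*i)))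

∤⇒∣i∣>0 : ∀ {m i} → ¬ + m ∣ₛ i → ∣ i ∣ > 0
∤⇒∣i∣>0 {m} m∤i = n≢0⇒n>0 λ ∣i∣≡0 → m∤i (∣ₙ⇒∣ₛ (subst (m ∣ₙ_) (sym ∣i∣≡0) (m ℕᵈ.∣0)))

coprime-*ˡ : ∀ {m n o} → Coprime m n → Coprime o n → Coprime (m ℕ.* o) n
coprime-*ˡ {m} m⊥n o⊥n {i} (i∣mo , i∣n) = o⊥n (coprime-divisor i⊥m i∣mo , i∣n)
  where
  i⊥m : Coprime i m
  i⊥m (j∣i , j∣m) = m⊥n (j∣m , ∣-trans j∣i i∣n)

∣12⇒≡1 : ∀ {g} → g ∣ₙ 12 → ¬ 2 ∣ₙ g → ¬ 3 ∣ₙ g → g ≡ 1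
∣12⇒≡1 g∣12 = divisorsOf12 (s≤s (ℕᵈ.∣⇒≤ g∣12)) g∣12
  where
  divisorsOf12 : ∀ {g} → g < 13 → g ∣ₙ 12 → ¬ 2 ∣ₙ g → ¬ 3 ∣ₙ g → g ≡ 1
  divisorsOf12 = from-yes (allUpTo?
    (λ g → g ∣? 12 →-dec ¬? (2 ∣? g) →-dec ¬? (3 ∣? g) →-dec g ℕ.≟ 1) 13)

%2≡1⇒2∤ : ∀ {k} → k % 2 ≡ 1 → ¬ + 2 ∣ₛ + k
%2≡1⇒2∤ {k} k%2≡1 2∣k = contradiction (trans (sym (ℕᵈ.n∣m⇒m%n≡0 k 2 (∣ₛ⇒∣ₙ 2∣k))) k%2≡1) λ ()

2∤⇒%2≡1 : ∀ {k} → ¬ + 2 ∣ₛ + k → k % 2 ≡ 1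
2∤⇒%2≡1 {k} 2∤k with k % 2 in k%2≡r | m%n<n k 2
... | 0           | _               = contradiction (∣ₙ⇒∣ₛ (ℕᵈ.m%n≡0⇒n∣m k 2 k%2≡r)) 2∤k
... | 1           | _               = refl
... | suc (suc _) | s≤s (s≤s ())

%-scaled-square : ∀ u x m .{{_ : ℕ.NonZero m}} →
                  (u ℕ.* (x % m ℕ.* (x % m))) % m ≡ (u ℕ.* (x ℕ.* x)) % m
%-scaled-square u x m = begin
  (u ℕ.* (x % m ℕ.* (x % m))) % m            ≡⟨ %-distribˡ-* u (x % m ℕ.* (x % m)) m ⟩
  (u % m ℕ.* ((x % m ℕ.* (x % m)) % m)) % m  ≡⟨ cong (λ t → (u % m ℕ.* t) % m) (sym (%-distribˡ-* x x m)) ⟩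
  (u % m ℕ.* ((x ℕ.* x) % m)) % m            ≡⟨ sym (%-distribˡ-* u (x ℕ.* x) m) ⟩
  (u ℕ.* (x ℕ.* x)) % m                      ∎
  where open ≡-Reasoning

equation-mod : ∀ {a c d} m .{{_ : ℕ.NonZero m}} →
               2 ℕ.* (a ℕ.* a) ℕ.+ c ℕ.* c ≡ 3 ℕ.* (d ℕ.* d) →
               (2 ℕ.* (a % m ℕ.* (a % m)) ℕ.+ c % m ℕ.* (c % m)) % m ≡ (3 ℕ.* (d % m ℕ.* (d % m))) % m
equation-mod {a} {c} {d} m eq = begin
  (2 ℕ.* (a % m ℕ.* (a % m)) ℕ.+ c % m ℕ.* (c % m)) % m
    ≡⟨ %-distribˡ-+ (2 ℕ.* (a % m ℕ.* (a % m))) (c % m ℕ.* (c % m)) m ⟩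
  ((2 ℕ.* (a % m ℕ.* (a % m))) % m ℕ.+ (c % m ℕ.* (c % m)) % m) % m
    ≡⟨ cong₂ (λ u v → (u ℕ.+ v) % m) (%-scaled-square 2 a m) (sym (%-distribˡ-* c c m)) ⟩
  ((2 ℕ.* (a ℕ.* a)) % m ℕ.+ (c ℕ.* c) % m) % m
    ≡⟨ sym (%-distribˡ-+ (2 ℕ.* (a ℕ.* a)) (c ℕ.* c) m) ⟩
  (2 ℕ.* (a ℕ.* a) ℕ.+ c ℕ.* c) % m
    ≡⟨ cong (_% m) eq ⟩
  (3 ℕ.* (d ℕ.* d)) % m
    ≡⟨ sym (%-scaled-square 3 d m) ⟩
  (3 ℕ.* (d % m ℕ.* (d % m))) % m ∎
  where open ≡-Reasoning

3∣a⇒3∣c⇒3∣d : ∀ {a c d} → 2 ℕ.* (a ℕ.* a) ℕ.+ c ℕ.* c ≡ 3 ℕ.* (d ℕ.* d) → 3 ∣ₙ a → 3 ∣ₙ c → 3 ∣ₙ d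
3∣a⇒3∣c⇒3∣d {d = d} eq (divides a′ refl) (divides c′ refl) = prime∣n*n⇒∣n prime[3]
  (divides (2 ℕ.* (a′ ℕ.* a′) ℕ.+ c′ ℕ.* c′)
    (*-cancelˡ-≡ (d ℕ.* d) _ 3 (trans (sym eq) (identity a′ c′))))
  where
  identity : ∀ a c → 2 ℕ.* ((a ℕ.* 3) ℕ.* (a ℕ.* 3)) ℕ.+ (c ℕ.* 3) ℕ.* (c ℕ.* 3)
                   ≡ 3 ℕ.* ((2 ℕ.* (a ℕ.* a) ℕ.+ c ℕ.* c) ℕ.* 3)
  identity = ℕ-solve-∀

◃-divMod : ∀ s n m .{{_ : ℕ.NonZero m}} → s ◃ n ≡ (s ◃ (n % m)) + (s ◃ (n / m)) * + m
◃-divMod s n m = begin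
  s ◃ n                                             ≡⟨ cong (s ◃_) (m≡m%n+[m/n]*n n m) ⟩
  s ◃ (n % m ℕ.+ n / m ℕ.* m)                       ≡⟨ ℤ.◃-distrib-+ s (n % m) (n / m ℕ.* m) ⟩
  (s ◃ (n % m)) + (s ◃ (n / m ℕ.* m))               ≡⟨ cong (λ t → (s ◃ (n % m)) + (t ◃ (n / m ℕ.* m))) (sym (Signᴾ.*-identityʳ s)) ⟩
  (s ◃ (n % m)) + ((s Sign.* Sign.+) ◃ (n / m ℕ.* m)) ≡⟨ cong (λ t → (s ◃ (n % m)) + t) (ℤ.◃-distrib-* s Sign.+ (n / m) m) ⟩
  (s ◃ (n % m)) + (s ◃ (n / m)) * (Sign.+ ◃ m)      ≡⟨ cong (λ t → (s ◃ (n % m)) + (s ◃ (n / m)) * t) (ℤ.+◃n≡+n m) ⟩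
  (s ◃ (n % m)) + (s ◃ (n / m)) * + m               ∎
  where open ≡-Reasoning

+-divMod : ∀ n m .{{_ : ℕ.NonZero m}} → + n ≡ + (n % m) + + (n / m) * + m
+-divMod n m = trans (sym (ℤ.+◃n≡+n n)) (trans (◃-divMod Sign.+ n m)
  (cong₂ (λ u v → u + v * + m) (ℤ.+◃n≡+n (n % m)) (ℤ.+◃n≡+n (n / m))))

pq≡r²⇒gcd[p,r]²≡p : ∀ {p q r} → p ℕ.* q ≡ r ℕ.* r → (∀ {g} → g ∣ₙ p → g ∣ₙ q → g ∣ₙ r → g ≡ 1) →
                    gcd p r ℕ.* gcd p r ≡ p
pq≡r²⇒gcd[p,r]²≡p {p} {q} {r} pq≡r² coprime = begin
  h ℕ.* h                           ≡⟨ c*gcd[m,n]≡gcd[cm,cn] h p r ⟩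
  gcd (h ℕ.* p) (h ℕ.* r)           ≡⟨ cong₂ gcd (*-comm h p) (*-comm h r) ⟩
  gcd (p ℕ.* h) (r ℕ.* h)           ≡⟨ cong (gcd (p ℕ.* h)) r*h≡p*gcd[r,q] ⟩
  gcd (p ℕ.* h) (p ℕ.* gcd r q)     ≡⟨ sym (c*gcd[m,n]≡gcd[cm,cn] p h (gcd r q)) ⟩
  p ℕ.* gcd h (gcd r q)             ≡⟨ cong (p ℕ.*_) gcd[h,r,q]≡1 ⟩
  p ℕ.* 1                           ≡⟨ *-identityʳ p ⟩
  p                                 ∎
  where
  open ≡-Reasoning
  h : ℕ
  h = gcd p r
  r*h≡p*gcd[r,q] : r ℕ.* h ≡ p ℕ.* gcd r q
  r*h≡p*gcd[r,q] = begin
    r ℕ.* gcd p r            ≡⟨ c*gcd[m,n]≡gcd[cm,cn] r p r ⟩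
    gcd (r ℕ.* p) (r ℕ.* r)  ≡⟨ cong₂ gcd (*-comm r p) (sym pq≡r²) ⟩
    gcd (p ℕ.* r) (p ℕ.* q)  ≡⟨ sym (c*gcd[m,n]≡gcd[cm,cn] p r q) ⟩
    p ℕ.* gcd r q            ∎
  gcd[h,r,q]≡1 : gcd h (gcd r q) ≡ 1
  gcd[h,r,q]≡1 = coprime
    (∣-trans (gcd[m,n]∣m h (gcd r q)) (gcd[m,n]∣m p r))
    (∣-trans (gcd[m,n]∣n h (gcd r q)) (gcd[m,n]∣n r q))
    (∣-trans (gcd[m,n]∣n h (gcd r q)) (gcd[m,n]∣m r q))

IsSolution : ℤ → ℤ → ℤ → Set
IsSolution x y z = + 2 * (x * x) + y * y ≡ + 3 * (z * z)

isSolution⇔ : ∀ x y z →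
  IsSolution x y z ⇔ (2 ℕ.* (∣ x ∣ ℕ.* ∣ x ∣) ℕ.+ ∣ y ∣ ℕ.* ∣ y ∣ ≡ 3 ℕ.* (∣ z ∣ ℕ.* ∣ z ∣))
isSolution⇔ x y z = mk⇔
  (λ sol → ℤ.+-injective (trans lhs (trans sol (sym rhs))))
  (λ eq → trans (sym lhs) (trans (cong +_ eq) rhs))
  where
  scaled : ∀ u i → + (u ℕ.* (∣ i ∣ ℕ.* ∣ i ∣)) ≡ + u * (i * i)
  scaled u i = trans (ℤ.pos-* u _) (cong (+ u *_) (+[∣i∣*∣i∣]≡i*i i))
  lhs : + (2 ℕ.* (∣ x ∣ ℕ.* ∣ x ∣) ℕ.+ ∣ y ∣ ℕ.* ∣ y ∣) ≡ + 2 * (x * x) + y * y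
  lhs = trans (ℤ.pos-+ (2 ℕ.* (∣ x ∣ ℕ.* ∣ x ∣)) (∣ y ∣ ℕ.* ∣ y ∣)) (cong₂ _+_ (scaled 2 x) (+[∣i∣*∣i∣]≡i*i y))
  rhs : + (3 ℕ.* (∣ z ∣ ℕ.* ∣ z ∣)) ≡ + 3 * (z * z)
  rhs = scaled 3 z

isSolution-◃ : ∀ {a c d} s t → 2 ℕ.* (a ℕ.* a) ℕ.+ c ℕ.* c ≡ 3 ℕ.* (d ℕ.* d) → IsSolution (s ◃ a) (t ◃ c) (+ d)
isSolution-◃ {a} {c} {d} s t eq = Equivalence.from (isSolution⇔ (s ◃ a) (t ◃ c) (+ d))
  (subst₂ (λ u v → 2 ℕ.* (u ℕ.* u) ℕ.+ v ℕ.* v ≡ 3 ℕ.* (d ℕ.* d)) (sym (ℤ.abs-◃ s a)) (sym (ℤ.abs-◃ t c)) eq)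

Primitive : ℤ → ℤ → ℤ → Set
Primitive x y z = ∀ {g} → + g ∣ₛ x → + g ∣ₛ y → + g ∣ₛ z → g ≡ 1

gcd≡1⇒primitive : ∀ {a c d} → gcd (gcd a c) d ≡ 1 → Primitive (+ a) (+ c) (+ d)
gcd≡1⇒primitive gcd≡1 g∣a g∣c g∣d =
  ∣1⇒≡1 (subst (_ ∣ₙ_) gcd≡1 (gcd-greatest (gcd-greatest (∣ₛ⇒∣ₙ g∣a) (∣ₛ⇒∣ₙ g∣c)) (∣ₛ⇒∣ₙ g∣d)))

primitive⇒gcd≡1 : ∀ {x y z} → Primitive x y z → gcd (gcd ∣ x ∣ ∣ y ∣) ∣ z ∣ ≡ 1
primitive⇒gcd≡1 {x} {y} {z} prim = prim
  (∣ₙ⇒∣ₛ (∣-trans g∣gcd[x,y] (gcd[m,n]∣m ∣ x ∣ ∣ y ∣)))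
  (∣ₙ⇒∣ₛ (∣-trans g∣gcd[x,y] (gcd[m,n]∣n ∣ x ∣ ∣ y ∣)))
  (∣ₙ⇒∣ₛ (gcd[m,n]∣n (gcd ∣ x ∣ ∣ y ∣) ∣ z ∣))
  where
  g∣gcd[x,y] : gcd (gcd ∣ x ∣ ∣ y ∣) ∣ z ∣ ∣ₙ gcd ∣ x ∣ ∣ y ∣
  g∣gcd[x,y] = gcd[m,n]∣m (gcd ∣ x ∣ ∣ y ∣) ∣ z ∣

primitive-≡ : ∀ {x y z x′ y′ z′} → x ≡ x′ → y ≡ y′ → z ≡ z′ → Primitive x y z → Primitive x′ y′ z′
primitive-≡ refl refl refl prim = prim

primitive-◃ : ∀ {a c d} s t → Primitive (+ a) (+ c) (+ d) → Primitive (s ◃ a) (t ◃ c) (+ d)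
primitive-◃ {a} {c} s t prim g∣x g∣y g∣z = prim (unsign s a g∣x) (unsign t c g∣y) g∣z
  where
  unsign : ∀ {g} s n → + g ∣ₛ s ◃ n → + g ∣ₛ + n
  unsign s n = ∣ₙ⇒∣ₛ ∘ subst (_ ∣ₙ_) (ℤ.abs-◃ s n) ∘ ∣ₛ⇒∣ₙ

-- The parametrising forms

aℤ cℤ dℤ : ℤ → ℤ → ℤ
aℤ l κ = + 2 * (l * l) + + 2 * (κ * l) - κ * κ
cℤ l κ = κ * κ + + 4 * (κ * l) - + 2 * (l * l)
dℤ l κ = + 2 * (l * l) + κ * κ

forms-isSolution : ∀ l κ → IsSolution (aℤ l κ) (cℤ l κ) (dℤ l κ)
forms-isSolution = identity
  where
  identity : ∀ l κ →
    + 2 * ((+ 2 * (l * l) + + 2 * (κ * l) - κ * κ) * (+ 2 * (l * l) + + 2 * (κ * l) - κ * κ))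
      + (κ * κ + + 4 * (κ * l) - + 2 * (l * l)) * (κ * κ + + 4 * (κ * l) - + 2 * (l * l))
    ≡ + 3 * ((+ 2 * (l * l) + κ * κ) * (+ 2 * (l * l) + κ * κ))
  identity = solve-∀

aℤ-neg : ∀ l κ → aℤ l (- κ) ≡ + 2 * (l * l) - + 2 * (κ * l) - κ * κ
aℤ-neg = identity
  where
  identity : ∀ l κ → + 2 * (l * l) + + 2 * (- κ * l) - - κ * - κ ≡ + 2 * (l * l) - + 2 * (κ * l) - κ * κ
  identity = solve-∀

cℤ-neg : ∀ l κ → cℤ l (- κ) ≡ κ * κ - + 4 * (κ * l) - + 2 * (l * l)
cℤ-neg = identity
  where
  identity : ∀ l κ → - κ * - κ + + 4 * (- κ * l) - + 2 * (l * l) ≡ κ * κ - + 4 * (κ * l) - + 2 * (l * l)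
  identity = solve-∀

dℤ≡+dOf : ∀ l κ → dℤ (+ l) κ ≡ + dOf l ∣ κ ∣
dℤ≡+dOf l κ = sym (begin
  + (2 ℕ.* (l ℕ.* l) ℕ.+ ∣ κ ∣ ℕ.* ∣ κ ∣)     ≡⟨ ℤ.pos-+ (2 ℕ.* (l ℕ.* l)) (∣ κ ∣ ℕ.* ∣ κ ∣) ⟩
  + (2 ℕ.* (l ℕ.* l)) + + (∣ κ ∣ ℕ.* ∣ κ ∣)   ≡⟨ cong₂ _+_ (ℤ.pos-* 2 (l ℕ.* l)) (+[∣i∣*∣i∣]≡i*i κ) ⟩
  + 2 * + (l ℕ.* l) + κ * κ                   ≡⟨ cong (λ t → + 2 * t + κ * κ) (ℤ.pos-* l l) ⟩
  + 2 * (+ l * + l) + κ * κ                   ∎)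
  where open ≡-Reasoning

∣monomials⇒∣forms : ∀ {i} l κ → i ∣ₛ + 2 * (l * l) → i ∣ₛ κ * l → i ∣ₛ κ * κ →
                    i ∣ₛ aℤ l κ × i ∣ₛ cℤ l κ × i ∣ₛ dℤ l κ
∣monomials⇒∣forms _ _ i∣2l² i∣κl i∣κ² =
  ℤᵈ.∣m∣n⇒∣m-n (ℤᵈ.∣m∣n⇒∣m+n i∣2l² (ℤᵈ.∣n⇒∣m*n (+ 2) i∣κl)) i∣κ² ,
  ℤᵈ.∣m∣n⇒∣m-n (ℤᵈ.∣m∣n⇒∣m+n i∣κ² (ℤᵈ.∣n⇒∣m*n (+ 4) i∣κl)) i∣2l² ,
  ℤᵈ.∣m∣n⇒∣m+n i∣2l² i∣κ²

3∣forms : ∀ l t → + 3 ∣ₛ aℤ l (t * + 3 + l) × + 3 ∣ₛ cℤ l (t * + 3 + l) × + 3 ∣ₛ dℤ l (t * + 3 + l)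
3∣forms l t =
  ℤᵈ.divides (l * l - + 3 * (t * t)) (a-identity l t) ,
  ℤᵈ.divides (+ 3 * (t * t) + + 6 * (t * l) + l * l) (c-identity l t) ,
  ℤᵈ.divides (+ 3 * (t * t) + + 2 * (t * l) + l * l) (d-identity l t)
  where
  a-identity : ∀ l t → + 2 * (l * l) + + 2 * ((t * + 3 + l) * l) - (t * + 3 + l) * (t * + 3 + l)
                     ≡ (l * l - + 3 * (t * t)) * + 3
  a-identity = solve-∀
  c-identity : ∀ l t → (t * + 3 + l) * (t * + 3 + l) + + 4 * ((t * + 3 + l) * l) - + 2 * (l * l)
                     ≡ (+ 3 * (t * t) + + 6 * (t * l) + l * l) * + 3
  c-identity = solve-∀
  d-identity : ∀ l t → + 2 * (l * l) + (t * + 3 + l) * (t * + 3 + l) ≡ (+ 3 * (t * t) + + 2 * (t * l) + l * l) * + 3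
  d-identity = solve-∀

-- Forms at admissible parameters are primitive solutions

3∤aℤ : ∀ l κ → ¬ + 3 ∣ₛ κ - l → ¬ + 3 ∣ₛ aℤ l κ
3∤aℤ l κ 3∤κ-l 3∣a = 3∤κ-l (prime∣i*i⇒∣i prime[3]
  (subst (+ 3 ∣ₛ_) (sym (identity l κ)) (ℤᵈ.∣m∣n⇒∣m-n (ℤᵈ.∣m⇒∣m*n (l * l) ℤᵈ.∣-refl) 3∣a)))
  where
  identity : ∀ l κ → (κ - l) * (κ - l) ≡ + 3 * (l * l) - (+ 2 * (l * l) + + 2 * (κ * l) - κ * κ)
  identity = solve-∀

3∤cℤ : ∀ l κ → ¬ + 3 ∣ₛ κ - l → ¬ + 3 ∣ₛ cℤ l κ
3∤cℤ l κ 3∤κ-l 3∣c = 3∤κ-l (subst (+ 3 ∣ₛ_) (sym (shift l κ))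
  (ℤᵈ.∣m∣n⇒∣m-n (prime∣i*i⇒∣i {i = κ + + 2 * l} prime[3] 3∣[κ+2l]²) (ℤᵈ.∣m⇒∣m*n l (ℤᵈ.∣-refl {+ 3}))))
  where
  square : ∀ l κ → (κ + + 2 * l) * (κ + + 2 * l) ≡ (κ * κ + + 4 * (κ * l) - + 2 * (l * l)) + + 3 * (+ 2 * (l * l))
  square = solve-∀
  shift : ∀ l κ → κ - l ≡ (κ + + 2 * l) - + 3 * l
  shift = solve-∀
  3∣[κ+2l]² : + 3 ∣ₛ (κ + + 2 * l) * (κ + + 2 * l)
  3∣[κ+2l]² = subst (+ 3 ∣ₛ_) (sym (square l κ)) (ℤᵈ.∣m∣n⇒∣m+n 3∣c (ℤᵈ.∣m⇒∣m*n (+ 2 * (l * l)) (ℤᵈ.∣-refl {+ 3})))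

2∤dℤ : ∀ l κ → ¬ + 2 ∣ₛ κ → ¬ + 2 ∣ₛ dℤ l κ
2∤dℤ l κ 2∤κ 2∣d = 2∤κ (prime∣i*i⇒∣i prime[2] (ℤᵈ.∣m+n∣m⇒∣n 2∣d (ℤᵈ.∣m⇒∣m*n (l * l) (ℤᵈ.∣-refl {+ 2}))))

forms-primitive : ∀ {l} κ → Coprime ∣ κ ∣ l → ¬ + 2 ∣ₛ κ → ¬ + 3 ∣ₛ κ - + l →
                  Primitive (aℤ (+ l) κ) (cℤ (+ l) κ) (dℤ (+ l) κ)
forms-primitive {l} κ κ⊥l 2∤κ 3∤κ-l {g} g∣a g∣c g∣d = ∣12⇒≡1 g∣12 2∤g 3∤g
  where
  2l²-divisible : ∀ {j} → + j ∣ₛ + l → + j ∣ₛ + 2 * (+ l * + l)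
  2l²-divisible j∣l = ℤᵈ.∣n⇒∣m*n (+ 2) (ℤᵈ.∣m⇒∣m*n (+ l) j∣l)

  g⊥l : Coprime g l
  g⊥l {j} (j∣g , j∣l) = coprime-*ˡ κ⊥l κ⊥l (j∣κ² , j∣l)
    where
    j∣κ² : j ∣ₙ ∣ κ ∣ ℕ.* ∣ κ ∣
    j∣κ² = subst (j ∣ₙ_) (ℤ.abs-* κ κ) (∣ₛ⇒∣ₙ (ℤᵈ.∣m+n∣m⇒∣n
      (ℤᵈ.∣-trans (∣ₙ⇒∣ₛ j∣g) g∣d) (2l²-divisible (∣ₙ⇒∣ₛ j∣l))))

  12l²-combination : ∀ l κ → (l * l) * + 12 ≡
    + 2 * (+ 2 * (l * l) + + 2 * (κ * l) - κ * κ) - (κ * κ + + 4 * (κ * l) - + 2 * (l * l))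
      + + 3 * (+ 2 * (l * l) + κ * κ)
  12l²-combination = solve-∀

  g∣l²*12 : g ∣ₙ (l ℕ.* l) ℕ.* 12
  g∣l²*12 = subst (g ∣ₙ_) (trans (ℤ.abs-* (+ l * + l) (+ 12)) (cong (ℕ._* 12) (ℤ.abs-* (+ l) (+ l))))
    (∣ₛ⇒∣ₙ (subst (+ g ∣ₛ_) (sym (12l²-combination (+ l) κ))
      (ℤᵈ.∣m∣n⇒∣m+n (ℤᵈ.∣m∣n⇒∣m-n (ℤᵈ.∣n⇒∣m*n (+ 2) g∣a) g∣c) (ℤᵈ.∣n⇒∣m*n (+ 3) g∣d))))

  g∣12 : g ∣ₙ 12
  g∣12 = coprime-divisor (Coprime.sym (coprime-*ˡ (Coprime.sym g⊥l) (Coprime.sym g⊥l))) g∣l²*12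

  2∤g : ¬ 2 ∣ₙ g
  2∤g 2∣g = 2∤dℤ (+ l) κ 2∤κ (ℤᵈ.∣-trans (∣ₙ⇒∣ₛ 2∣g) g∣d)

  3∤g : ¬ 3 ∣ₙ g
  3∤g 3∣g = 3∤aℤ (+ l) κ 3∤κ-l (ℤᵈ.∣-trans (∣ₙ⇒∣ₛ 3∣g) g∣a)

forms-posPrimSol : ∀ {l} κ → l > 0 → Coprime ∣ κ ∣ l → ¬ + 2 ∣ₛ κ → ¬ + 3 ∣ₛ κ - + l →
                 PosPrimSol ∣ aℤ (+ l) κ ∣ ∣ cℤ (+ l) κ ∣ (dOf l ∣ κ ∣)
forms-posPrimSol {l} κ l>0 κ⊥l 2∤κ 3∤κ-l =
  ∤⇒∣i∣>0 (3∤aℤ (+ l) κ 3∤κ-l) ,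
  ∤⇒∣i∣>0 (3∤cℤ (+ l) κ 3∤κ-l) ,
  ∤⇒∣i∣>0 {2} (subst (¬_ ∘ (+ 2 ∣ₛ_)) (dℤ≡+dOf l κ) (2∤dℤ (+ l) κ 2∤κ)) ,
  subst (λ d → 2 ℕ.* (a ℕ.* a) ℕ.+ c ℕ.* c ≡ 3 ℕ.* (d ℕ.* d)) ∣dℤ∣≡dOf
    (Equivalence.to (isSolution⇔ (aℤ (+ l) κ) (cℤ (+ l) κ) (dℤ (+ l) κ)) (forms-isSolution (+ l) κ)) ,
  subst (λ d → gcd (gcd a c) d ≡ 1) ∣dℤ∣≡dOf (primitive⇒gcd≡1 (forms-primitive κ κ⊥l 2∤κ 3∤κ-l))
  where
  a c : ℕ
  a = ∣ aℤ (+ l) κ ∣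
  c = ∣ cℤ (+ l) κ ∣

  ∣dℤ∣≡dOf : ∣ dℤ (+ l) κ ∣ ≡ dOf l ∣ κ ∣
  ∣dℤ∣≡dOf = cong ∣_∣ (dℤ≡+dOf l κ)

forms-posPrimSol-neg : ∀ {l k} → l > 0 → Coprime k l → ¬ + 2 ∣ₛ + k → ¬ + 3 ∣ₛ + k + + l →
                     PosPrimSol (aII l k) (cII l k) (dOf l k)
forms-posPrimSol-neg {l} {k} l>0 k⊥l 2∤k 3∤k+l =
  subst₂ (λ a c → PosPrimSol a c (dOf l k)) (cong ∣_∣ (aℤ-neg (+ l) (+ k))) (cong ∣_∣ (cℤ-neg (+ l) (+ k)))
    (subst (PosPrimSol ∣ aℤ (+ l) (- + k) ∣ ∣ cℤ (+ l) (- + k) ∣) (cong (dOf l) ∣-k∣≡k)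
      (forms-posPrimSol (- + k) l>0 (subst (λ n → Coprime n l) (sym ∣-k∣≡k) k⊥l) (2∤k ∘ ∣-neg) (3∤k+l ∘ ∣-neg ∘ subst (+ 3 ∣ₛ_) (sym (ℤ.neg-distrib-+ (+ k) (+ l))))))
  where
  ∣-k∣≡k : ∣ - + k ∣ ≡ k
  ∣-k∣≡k = ℤ.∣-i∣≡∣i∣ (+ k)

-- Every primitive solution comes from the forms

module _ (l : ℕ) (κ : ℤ) (prim : Primitive (aℤ (+ l) κ) (cℤ (+ l) κ) (dℤ (+ l) κ)) where

  private
    common-divisor≡1 : ∀ {g} → + g ∣ₛ aℤ (+ l) κ × + g ∣ₛ cℤ (+ l) κ × + g ∣ₛ dℤ (+ l) κ → g ≡ 1
    common-divisor≡1 (g∣a , g∣c , g∣d) = prim g∣a g∣c g∣d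

  forms-primitive⇒coprime : Coprime ∣ κ ∣ l
  forms-primitive⇒coprime (j∣κ , j∣l) = common-divisor≡1 (∣monomials⇒∣forms (+ l) κ
    (ℤᵈ.∣n⇒∣m*n (+ 2) (ℤᵈ.∣m⇒∣m*n (+ l) (∣ₙ⇒∣ₛ {i = + l} j∣l)))
    (ℤᵈ.∣m⇒∣m*n (+ l) (∣ₙ⇒∣ₛ {i = κ} j∣κ))
    (ℤᵈ.∣m⇒∣m*n κ (∣ₙ⇒∣ₛ {i = κ} j∣κ)))

  forms-primitive⇒2∤κ : ¬ + 2 ∣ₛ κ
  forms-primitive⇒2∤κ 2∣κ = contradiction (common-divisor≡1 (∣monomials⇒∣forms (+ l) κ
    (ℤᵈ.∣m⇒∣m*n (+ l * + l) (ℤᵈ.∣-refl {+ 2}))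
    (ℤᵈ.∣m⇒∣m*n (+ l) 2∣κ)
    (ℤᵈ.∣m⇒∣m*n κ 2∣κ))) λ ()

  forms-primitive⇒3∤κ-l : ¬ + 3 ∣ₛ κ - + l
  forms-primitive⇒3∤κ-l (ℤᵈ.divides t κ-l≡t*3) =
    contradiction (common-divisor≡1 (subst (λ κ → + 3 ∣ₛ aℤ (+ l) κ × + 3 ∣ₛ cℤ (+ l) κ × + 3 ∣ₛ dℤ (+ l) κ)
                                           (sym κ≡t*3+l) (3∣forms (+ l) t))) λ ()
    where
    split : ∀ κ l → κ ≡ κ - l + l
    split = solve-∀
    κ≡t*3+l : κ ≡ t * + 3 + + l
    κ≡t*3+l = trans (split κ (+ l)) (cong (_+ + l) κ-l≡t*3)

record SignCondition (x y z : ℤ) : Set where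
  constructor signCondition
  field
    12∣2x-y+3z : + 12 ∣ₛ + 2 * x - y + + 3 * z
    6∣x+y      : + 6 ∣ₛ x + y

signCondition? : ∀ x y z → Dec (SignCondition x y z)
signCondition? x y z = map′ (λ (e , s) → signCondition e s) (λ (signCondition e s) → e , s)
  (+ 12 ℤᵈ.∣? + 2 * x - y + + 3 * z ×-dec + 6 ℤᵈ.∣? x + y)

signCondition-+12 : ∀ {x y z x′ y′ z′} u v w → SignCondition x′ y′ z′ →
                    x ≡ x′ + u * + 12 → y ≡ y′ + v * + 12 → z ≡ z′ + w * + 12 → SignCondition x y z
signCondition-+12 {x′ = x′} {y′} {z′} u v w (signCondition 12∣e 6∣s) refl refl refl =
  signCondition
    (subst (+ 12 ∣ₛ_) (sym (shift₁₂ x′ y′ z′ u v w))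
      (ℤᵈ.∣m∣n⇒∣m+n 12∣e (ℤᵈ.∣n⇒∣m*n (+ 2 * u - v + + 3 * w) (ℤᵈ.∣-refl {+ 12}))))
    (subst (+ 6 ∣ₛ_) (sym (shift₆ x′ y′ u v))
      (ℤᵈ.∣m∣n⇒∣m+n 6∣s (ℤᵈ.∣n⇒∣m*n (+ 2 * (u + v)) (ℤᵈ.∣-refl {+ 6}))))
  where
  shift₁₂ : ∀ x y z u v w → + 2 * (x + u * + 12) - (y + v * + 12) + + 3 * (z + w * + 12)
                          ≡ (+ 2 * x - y + + 3 * z) + (+ 2 * u - v + + 3 * w) * + 12
  shift₁₂ = solve-∀
  shift₆ : ∀ x y u v → x + u * + 12 + (y + v * + 12) ≡ x + y + + 2 * (u + v) * + 6
  shift₆ = solve-∀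

ResidueCases : ℕ → ℕ → ℕ → Set
ResidueCases a c d =
  (2 ℕ.* (a ℕ.* a) ℕ.+ c ℕ.* c) % 12 ≡ (3 ℕ.* (d ℕ.* d)) % 12 →
  (2 ∣ₙ a × 2 ∣ₙ c × 2 ∣ₙ d) ⊎ (3 ∣ₙ a × 3 ∣ₙ c) ⊎ ∃[ s ] ∃[ t ] SignCondition (s ◃ a) (t ◃ c) (+ d)

∃-sign? : ∀ {P : Sign → Set} → (∀ s → Dec (P s)) → Dec (∃ P)
∃-sign? P? = map′
  [ (Sign.+ ,_) , (Sign.- ,_) ]′
  (λ { (Sign.+ , p) → inj₁ p ; (Sign.- , p) → inj₂ p })
  (P? Sign.+ ⊎-dec P? Sign.-)

-- Opaque because unfolding the decided table at its use site exhausts memory.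
opaque
  residueCases : ∀ {a c d} → a < 12 → c < 12 → d < 12 → ResidueCases a c d
  residueCases a<12 c<12 d<12 = table a<12 c<12 d<12
    where
    cases? : ∀ a c d → Dec (ResidueCases a c d)
    cases? a c d = (_ ℕ.≟ _) →-dec
      ((2 ∣? a ×-dec 2 ∣? c ×-dec 2 ∣? d) ⊎-dec (3 ∣? a ×-dec 3 ∣? c) ⊎-dec
       ∃-sign? λ s → ∃-sign? λ t → signCondition? (s ◃ a) (t ◃ c) (+ d))

    table : ∀ {a} → a < 12 → ∀ {c} → c < 12 → ∀ {d} → d < 12 → ResidueCases a c d
    table = from-yes (allUpTo? (λ a → allUpTo? (λ c → allUpTo? (cases? a c) 12) 12) 12)

solution⇒signCondition : ∀ {a c d} → 2 ℕ.* (a ℕ.* a) ℕ.+ c ℕ.* c ≡ 3 ℕ.* (d ℕ.* d) →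
                 Primitive (+ a) (+ c) (+ d) → ∃[ s ] ∃[ t ] SignCondition (s ◃ a) (t ◃ c) (+ d)
solution⇒signCondition {a} {c} {d} eq prim
  with residueCases (m%n<n a 12) (m%n<n c 12) (m%n<n d 12) (equation-mod {a} {c} {d} 12 eq)
... | inj₁ (2∣a , 2∣c , 2∣d) = contradiction (prim (lift 2∣a) (lift 2∣c) (lift 2∣d)) λ ()
  where
  lift : ∀ {n} → 2 ∣ₙ n % 12 → + 2 ∣ₛ + n
  lift = ∣ₙ⇒∣ₛ ∘ ∣n∣m%n⇒∣m (divides 6 refl)
... | inj₂ (inj₁ (3∣a , 3∣c)) = contradiction (prim (∣ₙ⇒∣ₛ 3∣a′) (∣ₙ⇒∣ₛ 3∣c′) (∣ₙ⇒∣ₛ (3∣a⇒3∣c⇒3∣d eq 3∣a′ 3∣c′))) λ ()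
  where
  3∣a′ : 3 ∣ₙ a
  3∣a′ = ∣n∣m%n⇒∣m (divides 4 refl) 3∣a
  3∣c′ : 3 ∣ₙ c
  3∣c′ = ∣n∣m%n⇒∣m (divides 4 refl) 3∣c
... | inj₂ (inj₂ (s , t , cond)) =
  s , t , signCondition-+12 (s ◃ (a / 12)) (t ◃ (c / 12)) (+ (d / 12)) cond
            (◃-divMod s a 12) (◃-divMod t c 12) (+-divMod d 12)

record Coordinates (x y z p q r : ℤ) : Set where
  constructor coordinates
  field
    x≡ : x ≡ + 2 * p - q + + 2 * r
    y≡ : y ≡ q - + 2 * p + + 4 * r
    z≡ : z ≡ + 2 * p + q

signCondition⇒coordinates : ∀ {x y z} → SignCondition x y z → ∃[ p ] ∃[ q ] ∃[ r ] Coordinates x y z p q r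
signCondition⇒coordinates {x} {y} {z} (signCondition (ℤᵈ.divides p e≡p*12) (ℤᵈ.divides r s≡r*6)) =
  p , z - + 2 * p , r , coordinates x≡ y≡ (solve (p ∷ z ∷ []))
  where
  open ≡-Reasoning
  x≡ : x ≡ + 2 * p - (z - + 2 * p) + + 2 * r
  x≡ = ℤ.*-cancelˡ-≡ (+ 12) x _ (begin
    + 12 * x                                                 ≡⟨ solve (x ∷ y ∷ z ∷ []) ⟩
    + 4 * (+ 2 * x - y + + 3 * z) - + 12 * z + + 4 * (x + y) ≡⟨ cong₂ (λ e s → + 4 * e - + 12 * z + + 4 * s) e≡p*12 s≡r*6 ⟩
    + 4 * (p * + 12) - + 12 * z + + 4 * (r * + 6)            ≡⟨ solve (p ∷ r ∷ z ∷ []) ⟩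
    + 12 * (+ 2 * p - (z - + 2 * p) + + 2 * r)               ∎)
  y≡ : y ≡ z - + 2 * p - + 2 * p + + 4 * r
  y≡ = begin
    y                                              ≡⟨ solve (x ∷ y ∷ []) ⟩
    x + y - x                                      ≡⟨ cong₂ _-_ s≡r*6 x≡ ⟩
    r * + 6 - (+ 2 * p - (z - + 2 * p) + + 2 * r)  ≡⟨ solve (p ∷ r ∷ z ∷ []) ⟩
    z - + 2 * p - + 2 * p + + 4 * r                ∎

coordinates-isSolution⇒pq≡r² : ∀ {x y z p q r} → Coordinates x y z p q r → IsSolution x y z → p * q ≡ r * r
coordinates-isSolution⇒pq≡r² {p = p} {q} {r} (coordinates refl refl refl) sol =
  sym (ℤ.i-j≡0⇒i≡j (r * r) (p * q) (ℤ.*-cancelˡ-≡ (+ 24) (r * r - p * q) (+ 0) (trans (identity p q r) (ℤ.i≡j⇒i-j≡0 sol))))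
  where
  identity : ∀ p q r → + 24 * (r * r - p * q)
    ≡ + 2 * ((+ 2 * p - q + + 2 * r) * (+ 2 * p - q + + 2 * r))
      + (q - + 2 * p + + 4 * r) * (q - + 2 * p + + 4 * r) - + 3 * ((+ 2 * p + q) * (+ 2 * p + q))
  identity = solve-∀

coordinates-primitive : ∀ {x y z p q r} → Coordinates x y z p q r → Primitive x y z → Primitive p q r
coordinates-primitive (coordinates refl refl refl) prim g∣p g∣q g∣r = prim
  (ℤᵈ.∣m∣n⇒∣m+n (ℤᵈ.∣m∣n⇒∣m-n (ℤᵈ.∣n⇒∣m*n (+ 2) g∣p) g∣q) (ℤᵈ.∣n⇒∣m*n (+ 2) g∣r))
  (ℤᵈ.∣m∣n⇒∣m+n (ℤᵈ.∣m∣n⇒∣m-n g∣q (ℤᵈ.∣n⇒∣m*n (+ 2) g∣p)) (ℤᵈ.∣n⇒∣m*n (+ 4) g∣r))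
  (ℤᵈ.∣m∣n⇒∣m+n (ℤᵈ.∣n⇒∣m*n (+ 2) g∣p) g∣q)

pq≡r²⇒p≥0 : ∀ {p q r d} → p * q ≡ r * r → + 2 * p + q ≡ + d → p ≡ + ∣ p ∣
pq≡r²⇒p≥0 {+ n}                         _     _  = refl
pq≡r²⇒p≥0 { -[1+ n ]} {+ zero}          _     ()
pq≡r²⇒p≥0 { -[1+ n ]} {+ suc m} {r}     pq≡r² _  with trans pq≡r² (sym (+[∣i∣*∣i∣]≡i*i r))
... | ()
pq≡r²⇒p≥0 { -[1+ n ]} { -[1+ m ]}       _     ()

pq≡r²⇒squares : ∀ {p q r d} → p * q ≡ r * r → Primitive p q r → + 2 * p + q ≡ + d →
                ∃[ l ] ∃[ κ ] (p ≡ + l * + l × q ≡ κ * κ × r ≡ κ * + l)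
pq≡r²⇒squares {p} {q} {r} {d} pq≡r² prim 2p+q≡d = squares (gcd (∣ p ∣) (∣ r ∣)) refl
  where
  l²≡∣p∣ : gcd (∣ p ∣) (∣ r ∣) ℕ.* gcd (∣ p ∣) (∣ r ∣) ≡ ∣ p ∣
  l²≡∣p∣ = pq≡r²⇒gcd[p,r]²≡p
    (trans (sym (ℤ.abs-* p q)) (trans (cong ∣_∣ pq≡r²) (ℤ.abs-* r r)))
    (λ g∣p g∣q g∣r → prim (∣ₙ⇒∣ₛ g∣p) (∣ₙ⇒∣ₛ g∣q) (∣ₙ⇒∣ₛ g∣r))

  squares : ∀ l → gcd (∣ p ∣) (∣ r ∣) ≡ l → ∃[ l ] ∃[ κ ] (p ≡ + l * + l × q ≡ κ * κ × r ≡ κ * + l)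
  squares zero gcd≡0 = 0 , + 1 , p≡0 , trans q≡d (cong +_ d≡1) , r≡0
    where
    p≡0 : p ≡ + 0
    p≡0 = ℤ.∣i∣≡0⇒i≡0 (gcd[m,n]≡0⇒m≡0 gcd≡0)
    r≡0 : r ≡ + 0
    r≡0 = ℤ.∣i∣≡0⇒i≡0 (gcd[m,n]≡0⇒n≡0 ∣ p ∣ gcd≡0)
    q≡d : q ≡ + d
    q≡d = trans (sym (trans (cong (λ t → + 2 * t + q) p≡0) (ℤ.+-identityˡ q))) 2p+q≡d
    d≡1 : d ≡ 1
    d≡1 = prim (subst (+ d ∣ₛ_) (sym p≡0) (ℤᵈ.divides (+ 0) refl))
               (subst (+ d ∣ₛ_) (sym q≡d) ℤᵈ.∣-refl)
               (subst (+ d ∣ₛ_) (sym r≡0) (ℤᵈ.divides (+ 0) refl))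
  squares (suc l) gcd≡l = suc l , κ , p≡l² , q≡κ² , r≡κl
    where
    open ≡-Reasoning
    l∣r : + suc l ∣ₛ r
    l∣r = ∣ₙ⇒∣ₛ (subst (_∣ₙ ∣ r ∣) gcd≡l (gcd[m,n]∣n ∣ p ∣ ∣ r ∣))
    κ : ℤ
    κ = ℤᵈ._∣_.quotient l∣r
    r≡κl : r ≡ κ * + suc l
    r≡κl = ℤᵈ._∣_.equality l∣r
    p≡l² : p ≡ + suc l * + suc l
    p≡l² = begin
      p                        ≡⟨ pq≡r²⇒p≥0 {r = r} pq≡r² 2p+q≡d ⟩
      + ∣ p ∣                  ≡⟨ cong +_ (sym (subst (λ h → h ℕ.* h ≡ ∣ p ∣) gcd≡l l²≡∣p∣)) ⟩
      + (suc l ℕ.* suc l)      ≡⟨ ℤ.pos-* (suc l) (suc l) ⟩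
      + suc l * + suc l        ∎
    rearrange : ∀ κ l → (κ * l) * (κ * l) ≡ (l * l) * (κ * κ)
    rearrange = solve-∀
    q≡κ² : q ≡ κ * κ
    q≡κ² = ℤ.*-cancelˡ-≡ (+ suc l * + suc l) q (κ * κ) (begin
      (+ suc l * + suc l) * q              ≡⟨ cong (_* q) (sym p≡l²) ⟩
      p * q                                ≡⟨ pq≡r² ⟩
      r * r                                ≡⟨ cong₂ _*_ r≡κl r≡κl ⟩
      (κ * + suc l) * (κ * + suc l)        ≡⟨ rearrange κ (+ suc l) ⟩
      (+ suc l * + suc l) * (κ * κ)        ∎)

squares⇒forms : ∀ {x y z p q r} → Coordinates x y z p q r →
  ∃[ l ] ∃[ κ ] (p ≡ + l * + l × q ≡ κ * κ × r ≡ κ * + l) →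
  ∃[ l ] ∃[ κ ] (x ≡ aℤ (+ l) κ × y ≡ cℤ (+ l) κ × z ≡ dℤ (+ l) κ)
squares⇒forms (coordinates refl refl refl) (l , κ , refl , refl , refl) =
  l , κ , x-identity (+ l) κ , y-identity (+ l) κ , refl
  where
  x-identity : ∀ l κ → + 2 * (l * l) - κ * κ + + 2 * (κ * l) ≡ + 2 * (l * l) + + 2 * (κ * l) - κ * κ
  x-identity = solve-∀
  y-identity : ∀ l κ → κ * κ - + 2 * (l * l) + + 4 * (κ * l) ≡ κ * κ + + 4 * (κ * l) - + 2 * (l * l)
  y-identity = solve-∀

coordinates⇒forms : ∀ {x y d} → ∃[ p ] ∃[ q ] ∃[ r ] Coordinates x y (+ d) p q r →
  IsSolution x y (+ d) → Primitive x y (+ d) →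
  ∃[ l ] ∃[ κ ] (x ≡ aℤ (+ l) κ × y ≡ cℤ (+ l) κ × + d ≡ dℤ (+ l) κ)
coordinates⇒forms (_ , _ , _ , coords) sol prim = squares⇒forms coords
  (pq≡r²⇒squares (coordinates-isSolution⇒pq≡r² coords sol) (coordinates-primitive coords prim) (sym (Coordinates.z≡ coords)))

Parametrised : ℕ → ℕ → ℕ → Set
Parametrised a c d = ∃[ l ] ∃[ κ ] (a ≡ ∣ aℤ (+ l) κ ∣ × c ≡ ∣ cℤ (+ l) κ ∣ × + d ≡ dℤ (+ l) κ ×
                                    Primitive (aℤ (+ l) κ) (cℤ (+ l) κ) (dℤ (+ l) κ))

forms⇒param : ∀ {a c d} s t → Primitive (s ◃ a) (t ◃ c) (+ d) →
  ∃[ l ] ∃[ κ ] (s ◃ a ≡ aℤ (+ l) κ × t ◃ c ≡ cℤ (+ l) κ × + d ≡ dℤ (+ l) κ) →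
  Parametrised a c d
forms⇒param {a} {c} s t prim (l , κ , x≡a , y≡c , d≡d) =
  l , κ , trans (sym (ℤ.abs-◃ s a)) (cong ∣_∣ x≡a) , trans (sym (ℤ.abs-◃ t c)) (cong ∣_∣ y≡c) , d≡d ,
  primitive-≡ x≡a y≡c d≡d prim

solution⇒param : ∀ {a c d} → 2 ℕ.* (a ℕ.* a) ℕ.+ c ℕ.* c ≡ 3 ℕ.* (d ℕ.* d) → Primitive (+ a) (+ c) (+ d) →
                 Parametrised a c d
solution⇒param {a} {c} {d} eq prim = from-signs (solution⇒signCondition eq prim)
  where
  from-signs : ∃[ s ] ∃[ t ] SignCondition (s ◃ a) (t ◃ c) (+ d) → Parametrised a c d
  from-signs (s , t , cond) = forms⇒param s t (primitive-◃ s t prim)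
    (coordinates⇒forms (signCondition⇒coordinates cond) (isSolution-◃ {a} {c} {d} s t eq) (primitive-◃ s t prim))

∣κ∣≡1⇒trivial : ∀ κ → ∣ κ ∣ ≡ 1 → ∣ aℤ (+ 0) κ ∣ ≡ 1 × ∣ cℤ (+ 0) κ ∣ ≡ 1 × dℤ (+ 0) κ ≡ + 1
∣κ∣≡1⇒trivial (+ _)     refl = refl , refl , refl
∣κ∣≡1⇒trivial -[1+ _ ]  refl = refl , refl , refl

param⇒families : ∀ {a c d} → ¬ (a ≡ 1 × c ≡ 1 × d ≡ 1) → Parametrised a c d →
  ∃[ l ] ∃[ k ] (l > 0 × k > 0 × gcd k l ≡ 1 × k % 2 ≡ 1 × d ≡ dOf l k ×
    ((¬ (+ 3 ∣ (+ k - + l)) × a ≡ aI l k × c ≡ cI l k)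
     ⊎ (¬ (+ 3 ∣ (+ k + + l)) × a ≡ aII l k × c ≡ cII l k)))
param⇒families nontrivial (zero , κ , a≡ , c≡ , d≡ , prim) =
  let a≡1 , c≡1 , d≡1 = ∣κ∣≡1⇒trivial κ (forms-primitive⇒coprime 0 κ prim (ℕᵈ.∣-refl , ∣ κ ∣ ℕᵈ.∣0))
  in ⊥-elim (nontrivial (trans a≡ a≡1 , trans c≡ c≡1 , ℤ.+-injective (trans d≡ d≡1)))
param⇒families _ (suc l , + zero , _ , _ , _ , prim) =
  ⊥-elim (forms-primitive⇒2∤κ (suc l) (+ 0) prim (ℤᵈ.divides (+ 0) refl))
param⇒families _ (suc l , + suc k , a≡ , c≡ , d≡ , prim) =
  suc l , suc k , s≤s z≤n , s≤s z≤n ,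
  coprime⇒gcd≡1 (forms-primitive⇒coprime (suc l) (+ suc k) prim) ,
  2∤⇒%2≡1 (forms-primitive⇒2∤κ (suc l) (+ suc k) prim) ,
  ℤ.+-injective (trans d≡ (dℤ≡+dOf (suc l) (+ suc k))) ,
  inj₁ (forms-primitive⇒3∤κ-l (suc l) (+ suc k) prim ∘ ∣ᵤ⇒∣ , a≡ , c≡)
param⇒families _ (suc l , -[1+ k ] , a≡ , c≡ , d≡ , prim) =
  suc l , suc k , s≤s z≤n , s≤s z≤n ,
  coprime⇒gcd≡1 (forms-primitive⇒coprime (suc l) -[1+ k ] prim) ,
  2∤⇒%2≡1 (forms-primitive⇒2∤κ (suc l) -[1+ k ] prim ∘ ℤᵈ.∣m⇒∣-m) ,
  ℤ.+-injective (trans d≡ (dℤ≡+dOf (suc l) -[1+ k ])) ,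
  inj₂ (forms-primitive⇒3∤κ-l (suc l) -[1+ k ] prim ∘ subst (+ 3 ∣ₛ_) (ℤ.neg-distrib-+ (+ suc k) (+ suc l))
          ∘ ℤᵈ.∣m⇒∣-m ∘ ∣ᵤ⇒∣ ,
        trans a≡ (cong ∣_∣ (aℤ-neg (+ suc l) (+ suc k))) ,
        trans c≡ (cong ∣_∣ (cℤ-neg (+ suc l) (+ suc k))))

theorem2p1 :
    (∀ (l k : ℕ) → l > 0 → k > 0 → gcd k l ≡ 1 → k % 2 ≡ 1 →
       ¬ (+ 3 ∣ (+ k - + l)) → PosPrimSol (aI l k) (cI l k) (dOf l k))
    × (∀ (l k : ℕ) → l > 0 → k > 0 → gcd k l ≡ 1 → k % 2 ≡ 1 →
       ¬ (+ 3 ∣ (+ k + + l)) → PosPrimSol (aII l k) (cII l k) (dOf l k))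
    × (∀ (a c d : ℕ) → PosPrimSol a c d → ¬ (a ≡ 1 × c ≡ 1 × d ≡ 1) →
       ∃[ l ] ∃[ k ] (l > 0 × k > 0 × gcd k l ≡ 1 × k % 2 ≡ 1 × d ≡ dOf l k ×
         ((¬ (+ 3 ∣ (+ k - + l)) × a ≡ aI l k × c ≡ cI l k)
          ⊎ (¬ (+ 3 ∣ (+ k + + l)) × a ≡ aII l k × c ≡ cII l k))))
theorem2p1 =
  -- The hypothesis k > 0 is unused: k odd already excludes k = 0.
  (λ l k l>0 _ gcd≡1 odd 3∤k-l →
     forms-posPrimSol (+ k) l>0 (gcd≡1⇒coprime gcd≡1) (%2≡1⇒2∤ odd) (3∤k-l ∘ ∣⇒∣ᵤ)) ,
  (λ l k l>0 _ gcd≡1 odd 3∤k+l →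
     forms-posPrimSol-neg l>0 (gcd≡1⇒coprime gcd≡1) (%2≡1⇒2∤ odd) (3∤k+l ∘ ∣⇒∣ᵤ)) ,
  (λ a c d (_ , _ , _ , eq , gcd≡1) nontrivial →
     param⇒families nontrivial (solution⇒param eq (gcd≡1⇒primitive gcd≡1)))
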